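{- Let $C$ be a clause in the variables $x_{i,j}$ ($1\le i\le n+1$, $1\le j\le n$) with $|C|=k\le n/2$ such that: $C$ is not tautological; $C\not\supseteq H_{i,i',j}$ for every hole clause $H_{i,i',j}$; and $C\not\supseteq F_{i,j,j'}$ for every functional clause $F_{i,j,j'}$. Then there is a matching $\rho$ of size $|\rho|\le k$ such that $C|_\rho=\Box$, i.e. the assignment induced by $\rho$ sets every literal of $C$ to $0$.
   Context: A clause is a finite set of literals; it is tautological if it contains $x$ and $\overline x$ for some variable $x$. Hole clauses: $H_{i,i',j}=\{\overline x_{i,j},\overline x_{i',j}\}$ for $1\le i<i'\le n+1$, $1\le j\le n$. Functional clauses: $F_{i,j,j'}=\{\overline x_{i,j},\overline x_{i,j'}\}$ for $1\le i\le n+1$, $1\le j<j'\le n$. A matching is a set $\rho=\{(i_1,j_1),\dots,(i_m,j_m)\}\subseteq\{1,\dots,n+1\}\times\{1,\dots,n\}$ with the $i_\nu$ pairwise distinct and the $j_\nu$ pairwise distinct; $|\rho|=m$. It induces the partial assignment $\rho(x_{i,j})=1$ if $(i,j)\in\rho$; $\rho(x_{i,j})=0$ if there is $(i,j')\in\rho$ with $j'\ne j$ or $(i',j)\in\rho$ with $i'\neq i$; undefined otherwise (and $\rho(\overline x_{i,j})=1-\rho(x_{i,j})$). -}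

module Defs where

open import Data.Nat using (ℕ; suc)
open import Data.Fin using (Fin; _<_)
open import Data.Bool using (Bool; true; false)
open import Data.Product using (_×_; _,_; ∃; ∃-syntax; proj₁; proj₂)
open import Data.Sum using (_⊎_)
open import Data.List using (List; map)
open import Data.List.Membership.Propositional using (_∈_)
open import Data.List.Relation.Unary.All using (All)
open import Data.List.Relation.Unary.Unique.Propositional using (Unique)
open import Relation.Binary.PropositionalEquality using (_≡_; _≢_)
open import Relation.Nullary using (¬_)

-- Variables x_{i,j} with 1 ≤ i ≤ n+1, 1 ≤ j ≤ n, encoded (0-based) as
-- i : Fin (suc n), j : Fin n.
Var : ℕ → Set
Var n = Fin (suc n) × Fin n

-- A literal: polarity true = x_{i,j}, polarity false = the negation of x_{i,j}.
record Literal (n : ℕ) : Set where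
  constructor lit
  field
    pos : Bool
    var : Var n
open Literal public

-- A clause is a finite set of literals: a duplicate-free list.
-- Its size |C| is the length of the list.
record Clause (n : ℕ) : Set where
  constructor clause
  field
    lits   : List (Literal n)
    unique : Unique lits
open Clause public

Tautological : ∀ {n} → Clause n → Set
Tautological {n} C = ∃[ v ] (lit true v ∈ lits C × lit false v ∈ lits C)

ContainsHole : ∀ {n} → Clause n → Fin (suc n) → Fin (suc n) → Fin n → Set
ContainsHole C i i' j = lit false (i , j) ∈ lits C × lit false (i' , j) ∈ lits C

ContainsFunctional : ∀ {n} → Clause n → Fin (suc n) → Fin n → Fin n → Set
ContainsFunctional C i j j' = lit false (i , j) ∈ lits C × lit false (i , j') ∈ lits C

record Matching (n : ℕ) : Set where
  constructor matching
  field
    pairs     : List (Var n)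
    uniqueFst : Unique (map proj₁ pairs)
    uniqueSnd : Unique (map proj₂ pairs)
open Matching public

SetsTrue : ∀ {n} → Matching n → Var n → Set
SetsTrue ρ v = v ∈ pairs ρ

SetsFalse : ∀ {n} → Matching n → Var n → Set
SetsFalse ρ (i , j) =
  (∃[ j' ] (j' ≢ j × (i , j') ∈ pairs ρ)) ⊎ (∃[ i' ] (i' ≢ i × (i' , j) ∈ pairs ρ))

LitFalsified : ∀ {n} → Matching n → Literal n → Set
LitFalsified ρ (lit true v)  = SetsFalse ρ v
LitFalsified ρ (lit false v) = SetsTrue ρ v

Falsifies : ∀ {n} → Matching n → Clause n → Set
Falsifies ρ C = All (LitFalsified ρ) (lits C)

-- Every negative literal ¬x_{i,j} of C is falsified by putting (i,j) into ρ; since C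
-- contains no hole or functional clause, these pairs already form a matching, and since C
-- is not tautological they never make a positive literal of C true. A positive literal
-- x_{i,j} is then falsified either because row i is already matched (to a column other
-- than j), or by matching row i to a column j' that is free in ρ and occurs nowhere in C.
-- Each positive literal costs at most one pair, so |ρ| ≤ k, and at each step at most
-- (k - 1) + k < n columns are excluded, which is where 2k ≤ n is needed.
module Submission where

open import Defs
open import Data.Nat using (ℕ; suc; _≤_; _*_)
open import Data.Fin using (Fin; _<_)
open import Data.List using (length)
open import Data.Product using (Σ; _×_)
open import Relation.Nullary using (¬_)

open import Data.Bool using (true; false)
open import Data.Empty using (⊥-elim)
open import Data.Fin using (toℕ)
open import Data.Fin.Properties using (<-cmp; pigeonhole; ¬∀⟶∃¬) renaming (_≟_ to _≟ᶠ_)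
open import Data.List using (List; []; _∷_; map; _++_; lookup)
open import Data.List.Membership.Propositional using (_∈_; _∉_)
open import Data.List.Membership.Propositional.Properties using (∈-map⁺; ∈-map⁻; ∈-++⁺ˡ; ∈-++⁺ʳ)
open import Data.List.Properties using (length-++; length-map)
open import Data.List.Relation.Binary.Subset.Propositional using (_⊆_)
open import Data.List.Relation.Binary.Subset.Propositional.Properties using (⊆-refl; ⊆-trans)
open import Data.List.Relation.Unary.All using (All; []; _∷_)
import Data.List.Relation.Unary.All as All
open import Data.List.Relation.Unary.All.Properties.Core using (¬Any⇒All¬)
open import Data.List.Relation.Unary.AllPairs using (AllPairs; []; _∷_)
import Data.List.Relation.Unary.AllPairs.Properties as AllPairs
open import Data.List.Relation.Unary.Any using (here; there; index; any?)
open import Data.List.Relation.Unary.Any.Properties using (lookup-result)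
import Data.Nat as ℕ
open import Data.Nat using (_+_; s≤s; z≤n)
open import Data.Nat.Properties
  using (≤-refl; ≤-trans; ≤-reflexive; n≤1+n; m≤m+n; +-suc; +-identityʳ; +-monoˡ-≤; m<m+n; <⇒≢; module ≤-Reasoning)
open import Data.Product using (_,_; ∃; proj₁; proj₂)
open import Data.Sum using (inj₁; inj₂)
open import Function using (_∘_)
open import Level using (0ℓ)
open import Relation.Binary using (Rel)
open import Relation.Binary.Definitions using (tri<; tri≈; tri>)
open import Relation.Binary.PropositionalEquality using (_≡_; _≢_; refl; sym; trans; cong; cong₂)
open import Relation.Nullary using (yes; no)

∃∉-of-length< : ∀ {m} (xs : List (Fin m)) → length xs ℕ.< m → ∃ (_∉ xs)
∃∉-of-length< {m} xs |xs|<m = ¬∀⟶∃¬ m (_∈ xs) (λ j → any? (j ≟ᶠ_) xs) not-all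
  where
  not-all : ¬ (∀ j → j ∈ xs)
  not-all all∈ with pigeonhole |xs|<m (index ∘ all∈)
  ... | i , j , i<j , same-index =
    <⇒≢ i<j (cong toℕ
      (trans (lookup-result (all∈ i))
        (trans (cong (lookup xs) same-index) (sym (lookup-result (all∈ j))))))

≡-of-no-ordered-pair : ∀ {m} {Q : Fin m → Set} →
  (∀ {a b} → a < b → ¬ (Q a × Q b)) → ∀ {a b} → Q a → Q b → a ≡ b
≡-of-no-ordered-pair no-pair {a} {b} qa qb with <-cmp a b
... | tri< a<b _ _ = ⊥-elim (no-pair a<b (qa , qb))
... | tri≈ _ a≡b _ = a≡b
... | tri> _ _ b<a = ⊥-elim (no-pair b<a (qb , qa))

extend : ∀ {n} (ρ : Matching n) (v : Var n) →
  proj₁ v ∉ map proj₁ (pairs ρ) → proj₂ v ∉ map proj₂ (pairs ρ) → Matching n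
extend ρ v row-free column-free =
  matching (v ∷ pairs ρ) (¬Any⇒All¬ _ row-free ∷ uniqueFst ρ) (¬Any⇒All¬ _ column-free ∷ uniqueSnd ρ)

LitFalsified-mono : ∀ {n} {ρ ρ' : Matching n} (l : Literal n) →
  pairs ρ ⊆ pairs ρ' → LitFalsified ρ l → LitFalsified ρ' l
LitFalsified-mono (lit true _) ρ⊆ρ' (inj₁ (j' , j'≢j , ij'∈ρ)) = inj₁ (j' , j'≢j , ρ⊆ρ' ij'∈ρ)
LitFalsified-mono (lit true _) ρ⊆ρ' (inj₂ (i' , i'≢i , i'j∈ρ)) =
  inj₂ (i' , i'≢i , ρ⊆ρ' i'j∈ρ)
LitFalsified-mono (lit false _) ρ⊆ρ' v∈ρ = ρ⊆ρ' v∈ρ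

negativeVars : ∀ {n} → List (Literal n) → List (Var n)
negativeVars []                 = []
negativeVars (lit true _ ∷ ls)  = negativeVars ls
negativeVars (lit false v ∷ ls) = v ∷ negativeVars ls

countPositive : ∀ {n} → List (Literal n) → ℕ
countPositive []                 = 0
countPositive (lit true _ ∷ ls)  = suc (countPositive ls)
countPositive (lit false _ ∷ ls) = countPositive ls

module _ {n : ℕ} where

  ∈-negativeVars⁻ : ∀ {v : Var n} ls → v ∈ negativeVars ls → lit false v ∈ ls
  ∈-negativeVars⁻ (lit true _ ∷ ls)  p           = there (∈-negativeVars⁻ ls p)
  ∈-negativeVars⁻ (lit false _ ∷ ls) (here refl) = here refl
  ∈-negativeVars⁻ (lit false _ ∷ ls) (there p)   = there (∈-negativeVars⁻ ls p)

  length-negativeVars : (ls : List (Literal n)) →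
    length (negativeVars ls) + countPositive ls ≡ length ls
  length-negativeVars []                 = refl
  length-negativeVars (lit true _ ∷ ls)  =
    trans (+-suc _ (countPositive ls)) (cong suc (length-negativeVars ls))
  length-negativeVars (lit false _ ∷ ls) = cong suc (length-negativeVars ls)

  negativeVars-allPairs : ∀ {R : Rel (Var n) 0ℓ} ls → AllPairs _≢_ ls →
    (∀ {v w} → lit false v ∈ ls → lit false w ∈ ls → v ≢ w → R v w) →
    AllPairs R (negativeVars ls)
  negativeVars-allPairs []                 []      R-neg = []
  negativeVars-allPairs (lit true _ ∷ ls)  (_ ∷ u) R-neg =
    negativeVars-allPairs ls u (λ p q → R-neg (there p) (there q))
  negativeVars-allPairs (lit false v ∷ ls) (v∉ls ∷ u) R-neg =
    All.tabulate (λ {w} w∈ls → R-neg (here refl) (there (∈-negativeVars⁻ ls w∈ls))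
                                 (λ { refl → All.lookup v∉ls (∈-negativeVars⁻ ls w∈ls) refl }))
    ∷ negativeVars-allPairs ls u (λ p q → R-neg (there p) (there q))

HoleFree : ∀ {n} → Clause n → Set
HoleFree {n} C = ∀ (i i' : Fin (suc n)) (j : Fin n) → i < i' → ¬ ContainsHole C i i' j

FunctionalFree : ∀ {n} → Clause n → Set
FunctionalFree {n} C = ∀ (i : Fin (suc n)) (j j' : Fin n) → j < j' → ¬ ContainsFunctional C i j j'

module _ {n : ℕ} (C : Clause n) where

  Admissible : Matching n → Set
  Admissible ρ = ∀ {v} → v ∈ pairs ρ → lit true v ∉ lits C

  columns : List (Fin n)
  columns = map (proj₂ ∘ var) (lits C)

  negativeMatching : HoleFree C → FunctionalFree C → Matching n
  negativeMatching hole-free functional-free =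
    matching (negativeVars (lits C))
      (AllPairs.map⁺ (negativeVars-allPairs (lits C) (unique C) rows-differ))
      (AllPairs.map⁺ (negativeVars-allPairs (lits C) (unique C) columns-differ))
    where
    rows-differ : ∀ {v w} → lit false v ∈ lits C → lit false w ∈ lits C → v ≢ w → proj₁ v ≢ proj₁ w
    rows-differ {i , j} {.i , j'} v∈C w∈C v≢w refl =
      v≢w (cong (i ,_) (≡-of-no-ordered-pair (functional-free i _ _) v∈C w∈C))
    columns-differ : ∀ {v w} → lit false v ∈ lits C → lit false w ∈ lits C → v ≢ w → proj₂ v ≢ proj₂ w
    columns-differ {i , j} {i' , .j} v∈C w∈C v≢w refl =
      v≢w (cong (_, j) (≡-of-no-ordered-pair (λ i<i' → hole-free _ _ j i<i') v∈C w∈C))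

  negativeMatching-admissible : (hole-free : HoleFree C) (functional-free : FunctionalFree C) →
    ¬ Tautological C → Admissible (negativeMatching hole-free functional-free)
  negativeMatching-admissible _ _ not-tautological {v} v∈ρ v∈C =
    not-tautological (v , v∈C , ∈-negativeVars⁻ (lits C) v∈ρ)

  module _ (small : 2 * length (lits C) ≤ n) where

    falsify-positive : ∀ {i j} → lit true (i , j) ∈ lits C →
      (ρ : Matching n) → Admissible ρ → length (pairs ρ) ℕ.< length (lits C) →
      Σ (Matching n) λ ρ' → Admissible ρ' × pairs ρ ⊆ pairs ρ' ×
        length (pairs ρ') ≤ suc (length (pairs ρ)) × SetsFalse ρ' (i , j)
    falsify-positive {i} {j} ij∈C ρ admissible |ρ|<|C|
      with any? (i ≟ᶠ_) (map proj₁ (pairs ρ))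
    ... | yes i-matched with ∈-map⁻ proj₁ i-matched
    ...   | (.i , j₀) , ij₀∈ρ , refl =
      ρ , admissible , ⊆-refl , n≤1+n _ ,
      inj₁ (j₀ , (λ { refl → admissible ij₀∈ρ ij∈C }) , ij₀∈ρ)
    falsify-positive {i} {j} ij∈C ρ admissible |ρ|<|C| | no i-free =
      ρ' , admissible' , there , ≤-refl , inj₁ (j' , j'≢j , here refl)
      where
      excluded : List (Fin n)
      excluded = map proj₂ (pairs ρ) ++ columns
      |excluded|<n : length excluded ℕ.< n
      |excluded|<n = begin-strict
        length excluded                      ≡⟨ trans (length-++ (map proj₂ (pairs ρ)))
                                                  (cong₂ _+_ (length-map proj₂ (pairs ρ))
                                                             (length-map (proj₂ ∘ var) (lits C))) ⟩
        length (pairs ρ) + length (lits C)   <⟨ +-monoˡ-≤ (length (lits C)) |ρ|<|C| ⟩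
        length (lits C) + length (lits C)    ≡⟨ cong (length (lits C) +_) (sym (+-identityʳ _)) ⟩
        2 * length (lits C)                  ≤⟨ small ⟩
        n                                    ∎
        where open ≤-Reasoning
      fresh : ∃ (_∉ excluded)
      fresh = ∃∉-of-length< excluded |excluded|<n
      j' : Fin n
      j' = proj₁ fresh
      j'∉columns : j' ∉ columns
      j'∉columns = proj₂ fresh ∘ ∈-++⁺ʳ (map proj₂ (pairs ρ))
      j'≢j : j' ≢ j
      j'≢j refl = j'∉columns (∈-map⁺ (proj₂ ∘ var) ij∈C)
      ρ' : Matching n
      ρ' = extend ρ (i , j') i-free (proj₂ fresh ∘ ∈-++⁺ˡ)
      admissible' : Admissible ρ'
      admissible' (here refl) ij'∈C = j'∉columns (∈-map⁺ (proj₂ ∘ var) ij'∈C)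
      admissible' (there v∈ρ) = admissible v∈ρ

    falsify-all : ∀ ls → ls ⊆ lits C →
      (ρ : Matching n) → Admissible ρ → negativeVars ls ⊆ pairs ρ →
      length (pairs ρ) + countPositive ls ≤ length (lits C) →
      Σ (Matching n) λ ρ' → pairs ρ ⊆ pairs ρ' × length (pairs ρ') ≤ length (lits C) ×
        All (LitFalsified ρ') ls
    falsify-all [] _ ρ _ _ bound =
      ρ , ⊆-refl , ≤-trans (m≤m+n _ 0) bound , []
    falsify-all (lit false _ ∷ ls) ls⊆C ρ admissible negatives⊆ρ bound
      with falsify-all ls (ls⊆C ∘ there) ρ admissible (negatives⊆ρ ∘ there) bound
    ... | ρ' , ρ⊆ρ' , bound' , falsified =
      ρ' , ρ⊆ρ' , bound' , ρ⊆ρ' (negatives⊆ρ (here refl)) ∷ falsified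
    falsify-all (lit true v ∷ ls) ls⊆C ρ admissible negatives⊆ρ bound
      with falsify-positive (ls⊆C (here refl)) ρ admissible
             (≤-trans (m<m+n _ (s≤s z≤n)) bound)
    ... | ρ₁ , admissible₁ , ρ⊆ρ₁ , |ρ₁|≤1+|ρ| , v-false
      with falsify-all ls (ls⊆C ∘ there) ρ₁ admissible₁ (⊆-trans negatives⊆ρ ρ⊆ρ₁)
             (≤-trans (+-monoˡ-≤ (countPositive ls) |ρ₁|≤1+|ρ|)
               (≤-trans (≤-reflexive (sym (+-suc _ (countPositive ls)))) bound))
    ... | ρ' , ρ₁⊆ρ' , bound' , falsified =
      ρ' , ⊆-trans ρ⊆ρ₁ ρ₁⊆ρ' , bound' ,
      LitFalsified-mono {ρ = ρ₁} {ρ'} (lit true v) ρ₁⊆ρ' v-false ∷ falsified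

lemma8p5 : (n : ℕ) (C : Clause n) →
    2 * length (lits C) ≤ n →
    ¬ Tautological C →
    (∀ (i i' : Fin (suc n)) (j : Fin n) → i < i' → ¬ ContainsHole C i i' j) →
    (∀ (i : Fin (suc n)) (j j' : Fin n) → j < j' → ¬ ContainsFunctional C i j j') →
    Σ (Matching n) (λ ρ → length (pairs ρ) ≤ length (lits C) × Falsifies ρ C)
lemma8p5 n C small not-tautological hole-free functional-free
  with falsify-all C small (lits C) ⊆-refl (negativeMatching C hole-free functional-free)
         (negativeMatching-admissible C hole-free functional-free not-tautological)
         ⊆-refl (≤-reflexive (length-negativeVars (lits C)))
... | ρ , _ , |ρ|≤|C| , falsified = ρ , |ρ|≤|C| , falsified
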